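{- The class of matroids satisfying the symmetric strong circuit elimination property is closed under series minors.
   Context: A matroid $M$ has the symmetric strong circuit elimination property if, whenever $C_1$ and $C_2$ are circuits of $M$ and $e_1,e_2,e$ are elements with $e_1\in C_1-C_2$, $e_2\in C_2-C_1$ and $e\in C_1\cap C_2$, there is a circuit $C_3$ of $M$ with $\{e_1,e_2\}\subseteq C_3\subseteq (C_1\cup C_2)-e$. A series contraction of $M$ is the contraction of an element lying in a $2$-element cocircuit of $M$; a series minor of $M$ is a matroid obtained from $M$ by a sequence of deletions and series contractions. -}

module Defs where

open import Data.Nat using (ℕ)
open import Data.Fin using (Fin)
open import Data.Fin.Subset
  using (Subset; _∈_; _∉_; _⊆_; _∪_; _∩_; _-_; ⁅_⁆; Nonempty; ⊥)
open import Data.Product using (Σ; ∃; ∃-syntax; _×_)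
open import Relation.Nullary using (¬_; Dec)
open import Relation.Binary.PropositionalEquality using (_≡_; _≢_)

-- A (finite) set system on the universe Fin n: a ground set E together with
-- a family of subsets, the candidate circuits.  Matroids are described by their
-- circuits (as in the paper).
record SetSystem (n : ℕ) : Set₁ where
  constructor mkSys
  field
    ground : Subset n
    circ   : Subset n → Set
open SetSystem public

-- Circuit axioms of a matroid on ground set E (Oxley, Section 1.1), plus
-- decidability of the circuit predicate (automatic classically for a finite
-- family).
record IsMatroid {n : ℕ} (M : SetSystem n) : Set where
  field
    circ-dec    : (C : Subset n) → Dec (circ M C)
    circ-ground : ∀ C → circ M C → C ⊆ ground M
    C1          : ¬ circ M ⊥
    C2          : ∀ C D → circ M C → circ M D → C ⊆ D → C ≡ D
    C3          : ∀ C D (e : Fin n) → circ M C → circ M D → C ≢ D →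
                  e ∈ C → e ∈ D →
                  ∃[ F ] (circ M F × F ⊆ (C ∪ D) - e)

SSCE : {n : ℕ} → SetSystem n → Set
SSCE {n} M =
  ∀ (C₁ C₂ : Subset n) (e₁ e₂ e : Fin n) →
  circ M C₁ → circ M C₂ →
  e₁ ∈ C₁ → e₁ ∉ C₂ → e₂ ∈ C₂ → e₂ ∉ C₁ → e ∈ C₁ → e ∈ C₂ →
  ∃[ C₃ ] (circ M C₃ × e₁ ∈ C₃ × e₂ ∈ C₃ × C₃ ⊆ (C₁ ∪ C₂) - e)

-- Independent sets, bases, cocircuits (circuits of the dual matroid:
-- minimal subsets of E meeting every basis).
Indep : {n : ℕ} → SetSystem n → Subset n → Set
Indep M I = I ⊆ ground M × (∀ C → circ M C → ¬ (C ⊆ I))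

Basis : {n : ℕ} → SetSystem n → Subset n → Set
Basis M B = Indep M B × (∀ I → Indep M I → B ⊆ I → I ≡ B)

MeetsAllBases : {n : ℕ} → SetSystem n → Subset n → Set
MeetsAllBases M D = ∀ B → Basis M B → Nonempty (D ∩ B)

Cocircuit : {n : ℕ} → SetSystem n → Subset n → Set
Cocircuit M D =
  D ⊆ ground M × MeetsAllBases M D ×
  (∀ D′ → D′ ⊆ D → MeetsAllBases M D′ → D′ ≡ D)

delete : {n : ℕ} → SetSystem n → Fin n → SetSystem n
delete M e = mkSys (ground M - e) (λ C → circ M C × e ∉ C)

-- Contraction M / e : ground E - e, circuits = minimal nonempty members of
-- { C - e : C a circuit of M }  (Oxley, Prop. 3.1.11).
IsCircMinus : {n : ℕ} → SetSystem n → Fin n → Subset n → Set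
IsCircMinus M e D = ∃[ C ] (circ M C × D ≡ C - e)

contract : {n : ℕ} → SetSystem n → Fin n → SetSystem n
contract M e = mkSys (ground M - e)
  (λ D → IsCircMinus M e D × Nonempty D ×
         (∀ D′ → IsCircMinus M e D′ → Nonempty D′ → D′ ⊆ D → D′ ≡ D))

InSeriesPair : {n : ℕ} → SetSystem n → Fin n → Set
InSeriesPair M e = ∃[ f ] (f ≢ e × Cocircuit M (⁅ e ⁆ ∪ ⁅ f ⁆))

data SeriesMinor {n : ℕ} (M : SetSystem n) : SetSystem n → Set₁ where
  here  : SeriesMinor M M
  del   : ∀ {N} e → SeriesMinor M N → e ∈ ground N → SeriesMinor M (delete N e)
  scon  : ∀ {N} e → SeriesMinor M N → InSeriesPair N e → SeriesMinor M (contract N e)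

module Submission where

-- For a series pair {e, f}, every circuit through e also passes through f
-- and vice versa; hence C ↦ C - e preserves and reflects inclusion between
-- circuits, the circuits of N / e are exactly the sets C - e, and an elimination
-- in N / e is the image of one in N.  This orthogonality is where strong
-- elimination enters, through a basis exchange argument.

open import Defs
open import Data.Nat using (ℕ; _<_)
open import Data.Nat.Induction using (<-wellFounded)
open import Induction.WellFounded using (Acc; acc)
import Data.Bool.Properties as Bool
open import Data.Fin using (Fin; _≟_)
open import Data.Fin.Properties using (any?)
open import Data.Fin.Subset
  using (Subset; inside; outside; _∈_; _∉_; _⊆_; _⊈_; _⊂_; _∪_; _-_; _─_; ⁅_⁆; Nonempty; ⊥; ∣_∣)
open import Data.Fin.Subset.Properties
  using (_∈?_; _⊆?_; anySubset?; nonempty?; Empty-unique; ∉⊥; ⊆-antisym; ⊆-trans;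
         p⊆p∪q; q⊆p∪q; x∈p∪q⁻; x∈p∪q⁺; x∈p∩q⁺; x∈p∩q⁻; x∈⁅x⁆; x∈⁅y⁆⇒x≡y;
         x∈p∧x≢y⇒x∈p-y; x∈p∧x∉q⇒x∈p─q; p─q⊆p; p⊂q⇒∣p∣<∣q∣; ∪-comm)
open import Data.List using (List; []; _∷_; allFin)
open import Data.List.Relation.Unary.Any using (here; there)
open import Data.List.Membership.Propositional using () renaming (_∈_ to _∈ₗ_)
open import Data.List.Membership.Propositional.Properties using (∈-allFin)
open import Data.Vec using (_∷_)
open import Data.Vec.Properties using (≡-dec)
open import Data.Vec.Base using () renaming (here to hd; there to tl)
open import Data.Product using (∃-syntax; _×_; _,_; proj₁; proj₂)
open import Data.Sum using (_⊎_; inj₁; inj₂)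
import Data.Sum as Sum
open import Data.Empty using (⊥-elim)
open import Function using (id; _∘_)
open import Relation.Nullary using (¬_; Dec; yes; no; ¬?)
open import Relation.Nullary.Decidable using (_×-dec_)
open import Relation.Binary.PropositionalEquality
  using (_≡_; _≢_; refl; sym; cong; subst)

x∈p─q⇒x∉q : ∀ {n} {x : Fin n} (p q : Subset n) → x ∈ p ─ q → x ∉ q
x∈p─q⇒x∉q (inside ∷ p) (outside ∷ q) hd ()
x∈p─q⇒x∉q (_ ∷ p) (_ ∷ q) (tl x∈p─q) (tl x∈q) = x∈p─q⇒x∉q p q x∈p─q x∈q

module _ {n : ℕ} where

  x∈p-y⇒x≢y : ∀ {x y : Fin n} (p : Subset n) → x ∈ p - y → x ≢ y
  x∈p-y⇒x≢y {y = y} p x∈p-y refl = x∈p─q⇒x∉q p ⁅ y ⁆ x∈p-y (x∈⁅x⁆ y)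

  x∉p-x : ∀ {x : Fin n} (p : Subset n) → x ∉ p - x
  x∉p-x p x∈p-x = x∈p-y⇒x≢y p x∈p-x refl

  x∈p∪⁅y⁆⁻ : ∀ {x y : Fin n} (p : Subset n) → x ∈ p ∪ ⁅ y ⁆ → x ∈ p ⊎ x ≡ y
  x∈p∪⁅y⁆⁻ p x∈ = Sum.map₂ (x∈⁅y⁆⇒x≡y _) (x∈p∪q⁻ p ⁅ _ ⁆ x∈)

  x∈p-y∧x∈q⇒x∈q-y : ∀ {x y : Fin n} {q : Subset n} (p : Subset n) → x ∈ p - y → x ∈ q → x ∈ q - y
  x∈p-y∧x∈q⇒x∈q-y p x∈p-y x∈q = x∈p∧x≢y⇒x∈p-y x∈q (x∈p-y⇒x≢y p x∈p-y)

  p⊆r∧q⊆r⇒p∪q⊆r : ∀ {p q r : Subset n} → p ⊆ r → q ⊆ r → p ∪ q ⊆ r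
  p⊆r∧q⊆r⇒p∪q⊆r {p} {q} p⊆r q⊆r x∈ = Sum.[ p⊆r , q⊆r ] (x∈p∪q⁻ p q x∈)

  ⁅x⁆⊆p : ∀ {x : Fin n} {p : Subset n} → x ∈ p → ⁅ x ⁆ ⊆ p
  ⁅x⁆⊆p {x} x∈p y∈⁅x⁆ = subst (_∈ _) (sym (x∈⁅y⁆⇒x≡y x y∈⁅x⁆)) x∈p

  p⊆q∪⁅x⁆⇒p-x⊆q : ∀ {x : Fin n} {p q : Subset n} → p ⊆ q ∪ ⁅ x ⁆ → p - x ⊆ q
  p⊆q∪⁅x⁆⇒p-x⊆q {p = p} {q} p⊆ {y} y∈p-x with x∈p∪⁅y⁆⁻ q (p⊆ (p─q⊆p p _ y∈p-x))
  ... | inj₁ y∈q = y∈q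
  ... | inj₂ refl = ⊥-elim (x∉p-x p y∈p-x)

  p⊆q∪⁅x⁆∧x∉p⇒p⊆q : ∀ {x : Fin n} {p q : Subset n} → p ⊆ q ∪ ⁅ x ⁆ → x ∉ p → p ⊆ q
  p⊆q∪⁅x⁆∧x∉p⇒p⊆q p⊆ x∉p y∈p =
    p⊆q∪⁅x⁆⇒p-x⊆q p⊆ (x∈p∧x≢y⇒x∈p-y y∈p λ { refl → x∉p y∈p })

  p-x⊆q∧x∈q⇒p⊆q : ∀ {x : Fin n} {p q : Subset n} → p - x ⊆ q → x ∈ q → p ⊆ q
  p-x⊆q∧x∈q⇒p⊆q {x} p-x⊆q x∈q {y} y∈p with y ≟ x
  ... | yes refl = x∈q
  ... | no y≢x = p-x⊆q (x∈p∧x≢y⇒x∈p-y y∈p y≢x)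

  p⊆q∧x∉p⇒p⊆q-x : ∀ {x : Fin n} {p q : Subset n} → p ⊆ q → x ∉ p → p ⊆ q - x
  p⊆q∧x∉p⇒p⊆q-x p⊆q x∉p y∈p = x∈p∧x≢y⇒x∈p-y (p⊆q y∈p) λ { refl → x∉p y∈p }

  p⊆q∪r⇒p-x⊆q-x∪r : ∀ {x : Fin n} {p q r : Subset n} → p ⊆ q ∪ r → p - x ⊆ (q - x) ∪ r
  p⊆q∪r⇒p-x⊆q-x∪r {p = p} {q} {r} p⊆ y∈p-x with x∈p∪q⁻ q r (p⊆ (p─q⊆p p _ y∈p-x))
  ... | inj₁ y∈q = x∈p∪q⁺ (inj₁ (x∈p∧x≢y⇒x∈p-y y∈q (x∈p-y⇒x≢y p y∈p-x)))
  ... | inj₂ y∈r = x∈p∪q⁺ (inj₂ y∈r)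

  p⊆q∪r⇒p─r⊆q─r : ∀ {p q r : Subset n} → p ⊆ q ∪ r → p ─ r ⊆ q ─ r
  p⊆q∪r⇒p─r⊆q─r {p} {q} {r} p⊆ x∈p─r with x∈p∪q⁻ q r (p⊆ (p─q⊆p p r x∈p─r))
  ... | inj₁ x∈q = x∈p∧x∉q⇒x∈p─q x∈q (x∈p─q⇒x∉q p r x∈p─r)
  ... | inj₂ x∈r = ⊥-elim (x∈p─q⇒x∉q p r x∈p─r x∈r)

  p⊆q∪⁅x⁆⇒[r∪p]-x⊆r∪q : ∀ {x : Fin n} {p q r : Subset n} → p ⊆ q ∪ ⁅ x ⁆ → (r ∪ p) - x ⊆ r ∪ q
  p⊆q∪⁅x⁆⇒[r∪p]-x⊆r∪q {p = p} {q} {r} p⊆ y∈[r∪p]-x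
    with x∈p∪q⁻ r p (p─q⊆p (r ∪ p) _ y∈[r∪p]-x)
  ... | inj₁ y∈r = x∈p∪q⁺ (inj₁ y∈r)
  ... | inj₂ y∈p = x∈p∪q⁺ (inj₂ (p⊆q∪⁅x⁆⇒p-x⊆q p⊆ (x∈p-y∧x∈q⇒x∈q-y (r ∪ p) y∈[r∪p]-x y∈p)))

  p⊆[q∪r]-x⇒p-y⊆[q-y∪r-y]-x : ∀ {x y : Fin n} {p q r : Subset n} →
    p ⊆ (q ∪ r) - x → p - y ⊆ ((q - y) ∪ (r - y)) - x
  p⊆[q∪r]-x⇒p-y⊆[q-y∪r-y]-x {p = p} {q} {r} p⊆ z∈p-y with p⊆ (p─q⊆p p _ z∈p-y)
  ... | z∈[q∪r]-x = x∈p∧x≢y⇒x∈p-y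
    (x∈p∪q⁺ (Sum.map (x∈p-y∧x∈q⇒x∈q-y p z∈p-y) (x∈p-y∧x∈q⇒x∈q-y p z∈p-y)
                      (x∈p∪q⁻ q r (p─q⊆p (q ∪ r) _ z∈[q∪r]-x))))
    (x∈p-y⇒x≢y (q ∪ r) z∈[q∪r]-x)

  x∉p∧x∉q⇒x∉r : ∀ {x y : Fin n} {p q r : Subset n} → x ∉ p → x ∉ q → r ⊆ (p ∪ q) - y → x ∉ r
  x∉p∧x∉q⇒x∉r {p = p} {q} x∉p x∉q r⊆ x∈r =
    Sum.[ x∉p , x∉q ] (x∈p∪q⁻ p q (p─q⊆p (p ∪ q) _ (r⊆ x∈r)))

  ⊈⇒∃∉ : ∀ {p q : Subset n} → p ⊈ q → ∃[ x ] (x ∈ p × x ∉ q)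
  ⊈⇒∃∉ {p} {q} p⊈q with any? (λ x → (x ∈? p) ×-dec ¬? (x ∈? q))
  ... | yes witness = witness
  ... | no none = ⊥-elim (p⊈q p⊆q)
    where
    p⊆q : p ⊆ q
    p⊆q {x} x∈p with x ∈? q
    ... | yes x∈q = x∈q
    ... | no x∉q = ⊥-elim (none (x , x∈p , x∉q))

  ≢⊥⇒Nonempty : ∀ {p : Subset n} → p ≢ ⊥ → Nonempty p
  ≢⊥⇒Nonempty {p} p≢⊥ with nonempty? p
  ... | yes ne = ne
  ... | no empty = ⊥-elim (p≢⊥ (Empty-unique empty))

module MatroidProperties {n : ℕ} {M : SetSystem n} (isMatroid : IsMatroid M) where
  open IsMatroid isMatroid

  Indep-⊆ : ∀ {I J} → Indep M I → J ⊆ I → Indep M J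
  Indep-⊆ (I⊆E , acyclic) J⊆I =
    ⊆-trans J⊆I I⊆E , λ C c C⊆J → acyclic C c (⊆-trans C⊆J J⊆I)

  circuit⊆? : (S : Subset n) → Dec (∃[ C ] (circ M C × C ⊆ S))
  circuit⊆? S = anySubset? (λ C → circ-dec C ×-dec (C ⊆? S))

  Indep? : (S : Subset n) → Dec (Indep M S)
  Indep? S with S ⊆? ground M | circuit⊆? S
  ... | no S⊈E | _ = no (S⊈E ∘ proj₁)
  ... | yes _ | yes (C , c , C⊆S) = no λ indep → proj₂ indep C c C⊆S
  ... | yes S⊆E | no acyclic = yes (S⊆E , λ C c C⊆S → acyclic (C , c , C⊆S))

  dependent⇒circuit : ∀ {S} → S ⊆ ground M → ¬ Indep M S → ∃[ C ] (circ M C × C ⊆ S)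
  dependent⇒circuit {S} S⊆E dependent with circuit⊆? S
  ... | yes found = found
  ... | no acyclic = ⊥-elim (dependent (S⊆E , λ C c C⊆S → acyclic (C , c , C⊆S)))

  circuit-Indep-minus : ∀ {C x} → circ M C → x ∈ C → Indep M (C - x)
  circuit-Indep-minus {C} c x∈C =
    ⊆-trans (p─q⊆p C _) (circ-ground C c) ,
    λ G g G⊆C-x → x∉p-x C (G⊆C-x (subst (_ ∈_) (sym (C2 G C g c (⊆-trans G⊆C-x (p─q⊆p C _)))) x∈C))

  circuit⊆I∪⁅x⁆⇒x∈C : ∀ {I C x} → Indep M I → circ M C → C ⊆ I ∪ ⁅ x ⁆ → x ∈ C
  circuit⊆I∪⁅x⁆⇒x∈C {C = C} {x} (_ , acyclic) c C⊆ with x ∈? C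
  ... | yes x∈C = x∈C
  ... | no x∉C = ⊥-elim (acyclic C c (p⊆q∪⁅x⁆∧x∉p⇒p⊆q C⊆ x∉C))

  greedy : List (Fin n) → Subset n → Subset n
  greedy [] A = A
  greedy (x ∷ xs) A with Indep? (A ∪ ⁅ x ⁆)
  ... | yes _ = greedy xs (A ∪ ⁅ x ⁆)
  ... | no _ = greedy xs A

  greedy-spec : ∀ xs {A} → Indep M A →
    Indep M (greedy xs A) × A ⊆ greedy xs A ×
    (∀ {x} → x ∈ₗ xs → x ∈ greedy xs A ⊎ ¬ Indep M (greedy xs A ∪ ⁅ x ⁆))
  greedy-spec [] indep = indep , id , λ ()
  greedy-spec (x ∷ xs) {A} indep with Indep? (A ∪ ⁅ x ⁆)
  ... | yes indep′ =
    let (indepG , A∪x⊆G , saturated) = greedy-spec xs indep′ in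
    indepG , ⊆-trans (p⊆p∪q _) A∪x⊆G ,
    λ { (here refl) → inj₁ (A∪x⊆G (q⊆p∪q A _ (x∈⁅x⁆ x))) ; (there y∈xs) → saturated y∈xs }
  ... | no dependent =
    let (indepG , A⊆G , saturated) = greedy-spec xs indep in
    indepG , A⊆G ,
    λ { (here refl) → inj₂ λ indepG∪x →
          dependent (Indep-⊆ indepG∪x (p⊆r∧q⊆r⇒p∪q⊆r (⊆-trans A⊆G (p⊆p∪q _)) (q⊆p∪q _ _)))
      ; (there y∈xs) → saturated y∈xs }

  saturated⇒Basis : ∀ {B} → Indep M B → (∀ x → x ∈ B ⊎ ¬ Indep M (B ∪ ⁅ x ⁆)) → Basis M B
  saturated⇒Basis {B} indep saturated = indep , maximal
    where
    maximal : ∀ I → Indep M I → B ⊆ I → I ≡ B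
    maximal I indepI B⊆I = ⊆-antisym I⊆B B⊆I
      where
      I⊆B : I ⊆ B
      I⊆B {x} x∈I = Sum.[ id , (λ dependent → ⊥-elim
        (dependent (Indep-⊆ indepI (p⊆r∧q⊆r⇒p∪q⊆r B⊆I (⁅x⁆⊆p x∈I))))) ] (saturated x)

  extend-to-Basis : ∀ {A} → Indep M A → ∃[ B ] (Basis M B × A ⊆ B)
  extend-to-Basis {A} indep =
    let (indepG , A⊆G , saturated) = greedy-spec (allFin n) indep in
    greedy (allFin n) A , saturated⇒Basis indepG (λ x → saturated (∈-allFin x)) , A⊆G

  fundamental-circuit : ∀ {B x} → Basis M B → x ∈ ground M → x ∉ B →
    ∃[ C ] (circ M C × C ⊆ B ∪ ⁅ x ⁆ × x ∈ C)
  fundamental-circuit {B} {x} (indep , maximal) x∈E x∉B with Indep? (B ∪ ⁅ x ⁆)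
  ... | yes indep′ =
    ⊥-elim (x∉B (subst (x ∈_) (maximal _ indep′ (p⊆p∪q _)) (q⊆p∪q B _ (x∈⁅x⁆ x))))
  ... | no dependent with dependent⇒circuit (p⊆r∧q⊆r⇒p∪q⊆r (proj₁ indep) (⁅x⁆⊆p x∈E)) dependent
  ... | C , c , C⊆ = C , c , C⊆ , circuit⊆I∪⁅x⁆⇒x∈C indep c C⊆

  -- A circuit inside the new set must contain z, and eliminating z between it
  -- and D would leave a circuit inside I.
  exchange-Indep : ∀ {I D a z} → Indep M I → z ∈ ground M →
    circ M D → D ⊆ I ∪ ⁅ z ⁆ → a ∈ D → a ≢ z → Indep M ((I - a) ∪ ⁅ z ⁆)
  exchange-Indep {I} {D} {a} {z} indep z∈E d D⊆ a∈D a≢z =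
    p⊆r∧q⊆r⇒p∪q⊆r (⊆-trans (p─q⊆p I _) (proj₁ indep)) (⁅x⁆⊆p z∈E) , acyclic
    where
    z∈D : z ∈ D
    z∈D = circuit⊆I∪⁅x⁆⇒x∈C indep d D⊆
    acyclic : ∀ G → circ M G → ¬ (G ⊆ (I - a) ∪ ⁅ z ⁆)
    acyclic G g G⊆ with z ∈? G
    ... | no z∉G = proj₂ indep G g (⊆-trans (p⊆q∪⁅x⁆∧x∉p⇒p⊆q G⊆ z∉G) (p─q⊆p I _))
    ... | yes z∈G with C3 G D z g d G≢D z∈G z∈D
      where
      G≢D : G ≢ D
      G≢D refl = Sum.[ x∉p-x I , a≢z ] (x∈p∪⁅y⁆⁻ (I - a) (G⊆ a∈D))
    ... | F , f , F⊆ = proj₂ indep F f (⊆-trans F⊆ (p⊆q∪⁅x⁆⇒p-x⊆q G∪D⊆))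
      where
      G∪D⊆ : G ∪ D ⊆ I ∪ ⁅ z ⁆
      G∪D⊆ = p⊆r∧q⊆r⇒p∪q⊆r
        (⊆-trans G⊆ (p⊆r∧q⊆r⇒p∪q⊆r (⊆-trans (p─q⊆p I _) (p⊆p∪q _)) (q⊆p∪q I _))) D⊆

  module _ (ssce : SSCE M) where

    -- Induction on |D ─ B|: if the fundamental circuit of z ∈ D ─ B misses a,
    -- strong elimination of z between it and D keeps a and shrinks D ─ B.
    fundamental-circuit-through : ∀ {B P D a} → Basis M B → P ⊆ ground M →
      circ M D → a ∈ D → D ⊆ B ∪ P →
      ∃[ z ] (z ∈ P × z ∉ B × ∃[ D′ ] (circ M D′ × D′ ⊆ B ∪ ⁅ z ⁆ × a ∈ D′))
    fundamental-circuit-through {B} {P} {D₀} {a} basis P⊆E =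
      go D₀ (<-wellFounded ∣ D₀ ─ B ∣)
      where
      go : ∀ D → Acc _<_ ∣ D ─ B ∣ → circ M D → a ∈ D → D ⊆ B ∪ P →
        ∃[ z ] (z ∈ P × z ∉ B × ∃[ D′ ] (circ M D′ × D′ ⊆ B ∪ ⁅ z ⁆ × a ∈ D′))
      go D (acc smaller) d a∈D D⊆ with D ⊆? B
      ... | yes D⊆B = ⊥-elim (proj₂ (proj₁ basis) D d D⊆B)
      ... | no D⊈B with ⊈⇒∃∉ D⊈B
      ... | z , z∈D , z∉B
        with Sum.[ ⊥-elim ∘ z∉B , id ] (x∈p∪q⁻ B P (D⊆ z∈D))
      ... | z∈P with fundamental-circuit basis (P⊆E z∈P) z∉B
      ... | Dz , dz , Dz⊆ , z∈Dz with a ∈? Dz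
      ... | yes a∈Dz = z , z∈P , z∉B , Dz , dz , Dz⊆ , a∈Dz
      ... | no a∉Dz with Dz ⊆? D
      ... | yes Dz⊆D = ⊥-elim (a∉Dz (subst (a ∈_) (sym (C2 Dz D dz d Dz⊆D)) a∈D))
      ... | no Dz⊈D with ⊈⇒∃∉ Dz⊈D
      ... | e₂ , e₂∈Dz , e₂∉D with ssce D Dz a e₂ z d dz a∈D a∉Dz e₂∈Dz e₂∉D z∈D z∈Dz
      ... | F , f , a∈F , _ , F⊆ =
        go F (smaller (p⊂q⇒∣p∣<∣q∣ F─B⊂D─B)) f a∈F (⊆-trans F⊆D∪B (p⊆r∧q⊆r⇒p∪q⊆r D⊆ (p⊆p∪q P)))
        where
        F⊆D∪B : F ⊆ D ∪ B
        F⊆D∪B = ⊆-trans F⊆ (p⊆q∪⁅x⁆⇒[r∪p]-x⊆r∪q Dz⊆)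
        F─B⊂D─B : F ─ B ⊂ D ─ B
        F─B⊂D─B = p⊆q∪r⇒p─r⊆q─r F⊆D∪B ,
          z , x∈p∧x∉q⇒x∈p─q z∈D z∉B , x∉p-x (D ∪ Dz) ∘ F⊆ ∘ p─q⊆p F B

    basis-avoiding : ∀ {B a b P Q} → Basis M B → a ∈ B → circ M P → a ∈ P →
      circ M Q → b ∈ Q → a ∉ Q → Q - b ⊆ B → ∃[ B′ ] (Basis M B′ × a ∉ B′ × b ∉ B′)
    basis-avoiding {B} {a} {b} {P} {Q} basis a∈B p a∈P q b∈Q a∉Q Q-b⊆B
      with fundamental-circuit-through basis (circ-ground P p) p a∈P (q⊆p∪q B P)
    ... | z , z∈P , z∉B , D , d , D⊆ , a∈D
      with extend-to-Basis (exchange-Indep (proj₁ basis) (circ-ground P p z∈P) d D⊆ a∈D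
                                           λ { refl → z∉B a∈B })
    ... | B′ , basis′ , exchanged⊆B′ = B′ , basis′ , a∉B′ , b∉B′
      where
      a∉B′ : a ∉ B′
      a∉B′ a∈B′ = proj₂ (proj₁ basis′) D d
        (p-x⊆q∧x∈q⇒p⊆q (⊆-trans (p⊆q∪r⇒p-x⊆q-x∪r D⊆) exchanged⊆B′) a∈B′)
      b∉B′ : b ∉ B′
      b∉B′ b∈B′ = proj₂ (proj₁ basis′) Q q
        (p-x⊆q∧x∈q⇒p⊆q (⊆-trans (p⊆q∧x∉p⇒p⊆q-x Q-b⊆B (a∉Q ∘ p─q⊆p Q _))
                                 (⊆-trans (p⊆p∪q _) exchanged⊆B′)) b∈B′)

    module _ {e f : Fin n} (f≢e : f ≢ e) (cocircuit : Cocircuit M (⁅ e ⁆ ∪ ⁅ f ⁆)) where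

      basis-meets-series-pair : ∀ {B} → Basis M B → e ∈ B ⊎ f ∈ B
      basis-meets-series-pair {B} basis with proj₁ (proj₂ cocircuit) B basis
      ... | x , x∈ with x∈p∩q⁻ (⁅ e ⁆ ∪ ⁅ f ⁆) B x∈
      ... | x∈pair , x∈B = Sum.map (moved e) (moved f) (x∈p∪q⁻ ⁅ e ⁆ ⁅ f ⁆ x∈pair)
        where
        moved : ∀ y → x ∈ ⁅ y ⁆ → y ∈ B
        moved y x∈⁅y⁆ = subst (_∈ B) (x∈⁅y⁆⇒x≡y y x∈⁅y⁆) x∈B

      -- If C passes through e but not f, every basis contains f: otherwise f has
      -- a fundamental circuit, and extending C - e to a basis K gives a basis
      -- avoiding {e, f}, either K itself or the one from basis-avoiding.
      series-circuit : ∀ {C} → circ M C → e ∈ C → f ∈ C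
      series-circuit {C} c e∈C with f ∈? C
      ... | yes f∈C = f∈C
      ... | no f∉C = ⊥-elim (f≢e (sym (x∈⁅y⁆⇒x≡y f e∈⁅f⁆)))
        where
        f∈E : f ∈ ground M
        f∈E = proj₁ cocircuit (q⊆p∪q ⁅ e ⁆ _ (x∈⁅x⁆ f))
        f-in-every-basis : MeetsAllBases M ⁅ f ⁆
        f-in-every-basis B basis with f ∈? B
        ... | yes f∈B = f , x∈p∩q⁺ (x∈⁅x⁆ f , f∈B)
        ... | no f∉B
          with fundamental-circuit basis f∈E f∉B | extend-to-Basis (circuit-Indep-minus c e∈C)
        ... | P , p , _ , f∈P | K , basisK , C-e⊆K with basis-meets-series-pair basisK
        ... | inj₁ e∈K = ⊥-elim (proj₂ (proj₁ basisK) C c (p-x⊆q∧x∈q⇒p⊆q C-e⊆K e∈K))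
        ... | inj₂ f∈K with basis-avoiding basisK f∈K p f∈P c e∈C f∉C C-e⊆K
        ... | B′ , basis′ , f∉B′ , e∉B′ =
          ⊥-elim (Sum.[ e∉B′ , f∉B′ ] (basis-meets-series-pair basis′))
        e∈⁅f⁆ : e ∈ ⁅ f ⁆
        e∈⁅f⁆ = subst (e ∈_) (sym (proj₂ (proj₂ cocircuit) ⁅ f ⁆ (q⊆p∪q ⁅ e ⁆ _) f-in-every-basis))
                      (p⊆p∪q ⁅ f ⁆ (x∈⁅x⁆ e))

module _ {n : ℕ} {N : SetSystem n} (e : Fin n) where

  delete-IsMatroid : IsMatroid N → IsMatroid (delete N e)
  delete-IsMatroid isMatroid = record
    { circ-dec = λ C → circ-dec C ×-dec ¬? (e ∈? C)
    ; circ-ground = λ C (c , e∉C) x∈C →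
        x∈p∧x≢y⇒x∈p-y (circ-ground C c x∈C) λ { refl → e∉C x∈C }
    ; C1 = C1 ∘ proj₁
    ; C2 = λ C D (c , _) (d , _) → C2 C D c d
    ; C3 = λ C D x (c , e∉C) (d , e∉D) C≢D x∈C x∈D →
        let (F , f , F⊆) = C3 C D x c d C≢D x∈C x∈D
        in F , (f , x∉p∧x∉q⇒x∉r e∉C e∉D F⊆) , F⊆
    }
    where open IsMatroid isMatroid

  delete-SSCE : SSCE N → SSCE (delete N e)
  delete-SSCE ssce C₁ C₂ e₁ e₂ x (c₁ , e∉C₁) (c₂ , e∉C₂) e₁∈C₁ e₁∉C₂ e₂∈C₂ e₂∉C₁ x∈C₁ x∈C₂ =
    let (C₃ , c₃ , e₁∈C₃ , e₂∈C₃ , C₃⊆) =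
          ssce C₁ C₂ e₁ e₂ x c₁ c₂ e₁∈C₁ e₁∉C₂ e₂∈C₂ e₂∉C₁ x∈C₁ x∈C₂
    in C₃ , (c₃ , x∉p∧x∉q⇒x∉r e∉C₁ e∉C₂ C₃⊆) , e₁∈C₃ , e₂∈C₃ , C₃⊆

module SeriesContraction {n : ℕ} {N : SetSystem n} (isMatroid : IsMatroid N) (ssce : SSCE N)
  {e f : Fin n} (f≢e : f ≢ e) (cocircuit : Cocircuit N (⁅ e ⁆ ∪ ⁅ f ⁆)) where
  open IsMatroid isMatroid
  open MatroidProperties isMatroid using (series-circuit)

  e∈C⇒f∈C : ∀ {C} → circ N C → e ∈ C → f ∈ C
  e∈C⇒f∈C = series-circuit ssce f≢e cocircuit

  f∈C⇒e∈C : ∀ {C} → circ N C → f ∈ C → e ∈ C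
  f∈C⇒e∈C = series-circuit ssce (f≢e ∘ sym) (subst (Cocircuit N) (∪-comm ⁅ e ⁆ ⁅ f ⁆) cocircuit)

  circuit-minus-⊆⇒⊆ : ∀ {C C′} → circ N C → circ N C′ → C′ - e ⊆ C - e → C′ ⊆ C
  circuit-minus-⊆⇒⊆ {C} {C′} c c′ ⊆-e {x} x∈C′ with x ≟ e
  ... | yes refl = f∈C⇒e∈C c (p─q⊆p C _ (⊆-e (x∈p∧x≢y⇒x∈p-y (e∈C⇒f∈C c′ x∈C′) f≢e)))
  ... | no x≢e = p─q⊆p C _ (⊆-e (x∈p∧x≢y⇒x∈p-y x∈C′ x≢e))

  circuit-minus-nonempty : ∀ {C} → circ N C → Nonempty (C - e)
  circuit-minus-nonempty {C} c with e ∈? C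
  ... | yes e∈C = f , x∈p∧x≢y⇒x∈p-y (e∈C⇒f∈C c e∈C) f≢e
  ... | no e∉C with ≢⊥⇒Nonempty C≢⊥
    where
    C≢⊥ : C ≢ ⊥
    C≢⊥ refl = C1 c
  ... | x , x∈C = x , x∈p∧x≢y⇒x∈p-y x∈C λ { refl → e∉C x∈C }

  contract-circuit : ∀ {C} → circ N C → circ (contract N e) (C - e)
  contract-circuit {C} c = (C , c , refl) , circuit-minus-nonempty c , minimal
    where
    minimal : ∀ D → IsCircMinus N e D → Nonempty D → D ⊆ C - e → D ≡ C - e
    minimal _ (C′ , c′ , refl) _ ⊆-e = cong (_- e) (C2 C′ C c′ c (circuit-minus-⊆⇒⊆ c c′ ⊆-e))

  contract-IsMatroid : IsMatroid (contract N e)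
  contract-IsMatroid = record
    { circ-dec = circ-dec′
    ; circ-ground = λ { _ ((C , c , refl) , _) y∈C-e →
        x∈p∧x≢y⇒x∈p-y (circ-ground C c (p─q⊆p C _ y∈C-e)) (x∈p-y⇒x≢y C y∈C-e) }
    ; C1 = λ { (_ , (x , x∈⊥) , _) → ∉⊥ x∈⊥ }
    ; C2 = λ { D₁ D₂ (isD₁ , nonempty₁ , _) (_ , _ , minimal₂) →
                 minimal₂ D₁ isD₁ nonempty₁ }
    ; C3 = C3′
    }
    where
    circ-dec′ : ∀ D → Dec (circ (contract N e) D)
    circ-dec′ D with anySubset? (λ C → circ-dec C ×-dec ≡-dec Bool._≟_ D (C - e))
    ... | yes (C , c , refl) = yes (contract-circuit c)
    ... | no none = no (none ∘ proj₁)
    C3′ : ∀ D₁ D₂ x → circ (contract N e) D₁ → circ (contract N e) D₂ → D₁ ≢ D₂ →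
      x ∈ D₁ → x ∈ D₂ → ∃[ F ] (circ (contract N e) F × F ⊆ (D₁ ∪ D₂) - x)
    C3′ _ _ x ((C₁ , c₁ , refl) , _) ((C₂ , c₂ , refl) , _) D₁≢D₂ x∈D₁ x∈D₂
      with C3 C₁ C₂ x c₁ c₂ (λ { refl → D₁≢D₂ refl }) (p─q⊆p C₁ _ x∈D₁) (p─q⊆p C₂ _ x∈D₂)
    ... | F , f , F⊆ = F - e , contract-circuit f , p⊆[q∪r]-x⇒p-y⊆[q-y∪r-y]-x F⊆

  contract-SSCE : SSCE (contract N e)
  contract-SSCE _ _ e₁ e₂ x ((C₁ , c₁ , refl) , _) ((C₂ , c₂ , refl) , _)
                e₁∈D₁ e₁∉D₂ e₂∈D₂ e₂∉D₁ x∈D₁ x∈D₂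
    with ssce C₁ C₂ e₁ e₂ x c₁ c₂
           (p─q⊆p C₁ _ e₁∈D₁) (e₁∉D₂ ∘ x∈p-y∧x∈q⇒x∈q-y C₁ e₁∈D₁)
           (p─q⊆p C₂ _ e₂∈D₂) (e₂∉D₁ ∘ x∈p-y∧x∈q⇒x∈q-y C₂ e₂∈D₂)
           (p─q⊆p C₁ _ x∈D₁) (p─q⊆p C₂ _ x∈D₂)
  ... | C₃ , c₃ , e₁∈C₃ , e₂∈C₃ , C₃⊆ =
    C₃ - e , contract-circuit c₃ ,
    x∈p-y∧x∈q⇒x∈q-y C₁ e₁∈D₁ e₁∈C₃ , x∈p-y∧x∈q⇒x∈q-y C₂ e₂∈D₂ e₂∈C₃ ,
    p⊆[q∪r]-x⇒p-y⊆[q-y∪r-y]-x C₃⊆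

series-minor-preserves : ∀ {n} {M N : SetSystem n} → SeriesMinor M N →
  IsMatroid M × SSCE M → IsMatroid N × SSCE N
series-minor-preserves here = id
series-minor-preserves (del {N} e minor _) good =
  let (isMatroid , ssce) = series-minor-preserves minor good
  in delete-IsMatroid e isMatroid , delete-SSCE {N = N} e ssce
series-minor-preserves (scon e minor (f , f≢e , cocircuit)) good =
  let (isMatroid , ssce) = series-minor-preserves minor good
      open SeriesContraction isMatroid ssce f≢e cocircuit
  in contract-IsMatroid , contract-SSCE

lemma2p1 : (n : ℕ) (M : SetSystem n) → IsMatroid M → SSCE M →
    (N : SetSystem n) → SeriesMinor M N → SSCE N
lemma2p1 n M isMatroid ssce N minor = proj₂ (series-minor-preserves minor (isMatroid , ssce))
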